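{- For any path graph $P_n$ of order $n\ge 2$ and any pendant edge $e$ of $P_n$, there exists a minimum bondage set of $P_n$ which contains $e$.
   Context: For a graph $G=(V,E)$, $\gamma(G)$ is its domination number (minimum size of a dominating set). A bondage set is a set $\mathcal{E}\subseteq E$ with $\gamma(G-\mathcal{E})>\gamma(G)$; a minimum bondage set is a bondage set of minimum cardinality. A pendant edge is an edge incident to a vertex of degree 1. -}

module Defs where

open import Data.Nat using (ℕ; suc; _<_; _≤_)
open import Data.Fin using (Fin; inject₁) renaming (suc to fsuc)
open import Data.Fin.Subset using (Subset; _∈_; _∉_; ∣_∣; ⊥)
open import Data.Product using (Σ; ∃; _×_)
open import Data.Sum using (_⊎_)
open import Relation.Binary.PropositionalEquality using (_≡_)

-- The path P_(suc m): vertices Fin (suc m); edge k : Fin m joins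
-- vertex k (inject₁ k) and vertex k+1 (fsuc k).
-- An edge set of P_(suc m) is a Subset m of edge indices.

Adj : (m : ℕ) → Subset m → Fin (suc m) → Fin (suc m) → Set
Adj m F u v = Σ (Fin m) λ k → k ∉ F ×
  ((u ≡ inject₁ k × v ≡ fsuc k) ⊎ (u ≡ fsuc k × v ≡ inject₁ k))

Dominating : (m : ℕ) → Subset m → Subset (suc m) → Set
Dominating m F D = (v : Fin (suc m)) → v ∈ D ⊎ Σ (Fin (suc m)) λ u → u ∈ D × Adj m F u v

IsDomNumber : (m : ℕ) → Subset m → ℕ → Set
IsDomNumber m F g =
  (Σ (Subset (suc m)) λ D → Dominating m F D × ∣ D ∣ ≡ g) ×
  ((D : Subset (suc m)) → Dominating m F D → g ≤ ∣ D ∣)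

Bondage : (m : ℕ) → Subset m → Set
Bondage m F = Σ ℕ λ g → Σ ℕ λ g' →
  IsDomNumber m ⊥ g × IsDomNumber m F g' × g < g'

MinBondage : (m : ℕ) → Subset m → Set
MinBondage m F = Bondage m F × ((F' : Subset m) → Bondage m F' → ∣ F ∣ ≤ ∣ F' ∣)

Degree1 : (m : ℕ) → Fin (suc m) → Set
Degree1 m u = Σ (Fin (suc m)) λ w → Adj m ⊥ u w × ((w' : Fin (suc m)) → Adj m ⊥ u w' → w' ≡ w)

Pendant : (m : ℕ) → Fin m → Set
Pendant m k = Degree1 m (inject₁ k) ⊎ Degree1 m (fsuc k)

-- γ(P_n) = ⌈n/3⌉, and deleting an edge splits the path into two paths whose domination
-- numbers add up. Deleting a pendant edge therefore gives 1 + ⌈(n−1)/3⌉, which exceeds ⌈n/3⌉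
-- unless n ≡ 1 (mod 3). In that case no single edge is a bondage set, since
-- ⌈x/3⌉ + ⌈y/3⌉ ≤ ⌈(x+y)/3⌉ whenever x + y ≡ 1 (mod 3), whereas deleting both end edges
-- leaves 2 + ⌈(n−2)/3⌉ > ⌈n/3⌉. Domination of a path is reformulated as a left-to-right
-- scan, which turns the bound n ≤ 3∣D∣ and the splitting at a deleted edge into inductions.
module Submission where

open import Defs
open import Data.Nat using (ℕ; zero; suc; _+_; _*_; _≤_; _<_; z≤n; s≤s; _<?_; _≤?_)
open import Data.Nat.Properties using (≤-pred; ≰⇒>; ≮⇒≥; +-mono-≤; <⇒≱; module ≤-Reasoning; ≤-refl; ≤-trans; m≤n⇒m≤1+n; +-comm)
open import Data.Bool using (Bool; true; false; not; _∧_)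
open import Data.Fin using (Fin; zero; suc; inject₁; _↑ʳ_)
open import Data.Fin.Subset using (Subset; _∈_; _∉_; _⊆_; ∣_∣; ⊥; ⁅_⁆)
open import Data.Fin.Subset.Properties using (∣⁅x⁆∣≡1; x∈⁅x⁆; ∣⊥∣≡0; ∉⊥)
open import Data.Fin.Properties using (suc-injective)
open import Data.Vec using ([]; _∷_; _++_; splitAt; here; there)
open import Data.Product using (Σ; ∃-syntax; _×_; _,_; proj₂)
open import Relation.Nullary using (¬_; contradiction; yes; no)
open import Data.Sum using (_⊎_; inj₁; inj₂; [_,_]′)
open import Relation.Binary.PropositionalEquality using (_≡_; _≢_; refl; cong; sym; trans; subst)

⌈_/3⌉ : ℕ → ℕ
⌈ 0 /3⌉ = 0
⌈ 1 /3⌉ = 1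
⌈ 2 /3⌉ = 1
⌈ suc (suc (suc n)) /3⌉ = suc ⌈ n /3⌉

⌈/3⌉-mono-suc : ∀ n → ⌈ n /3⌉ ≤ ⌈ suc n /3⌉
⌈/3⌉-mono-suc 0 = z≤n
⌈/3⌉-mono-suc 1 = ≤-refl
⌈/3⌉-mono-suc 2 = ≤-refl
⌈/3⌉-mono-suc (suc (suc (suc n))) = s≤s (⌈/3⌉-mono-suc n)

⌈/3⌉-least : ∀ n d → n ≤ d * 3 → ⌈ n /3⌉ ≤ d
⌈/3⌉-least 0 d _ = z≤n
⌈/3⌉-least 1 (suc d) _ = s≤s z≤n
⌈/3⌉-least 2 (suc d) _ = s≤s z≤n
⌈/3⌉-least (suc (suc (suc n))) (suc d) (s≤s (s≤s (s≤s n≤3d))) = s≤s (⌈/3⌉-least n d n≤3d)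

⌈/3⌉-split-≤ : ∀ x y → ⌈ suc x /3⌉ + ⌈ suc y /3⌉ ≤ suc ⌈ x + suc y /3⌉
⌈/3⌉-split-≤ 0 y = ≤-refl
⌈/3⌉-split-≤ 1 y = s≤s (⌈/3⌉-mono-suc (suc y))
⌈/3⌉-split-≤ 2 y = s≤s (≤-trans (⌈/3⌉-mono-suc (suc y)) (⌈/3⌉-mono-suc (suc (suc y))))
⌈/3⌉-split-≤ (suc (suc (suc x))) y = s≤s (⌈/3⌉-split-≤ x y)

∉-head : ∀ {m f} {F : Subset m} → zero ∉ f ∷ F → f ≡ false
∉-head {f = false} _ = refl
∉-head {f = true} zero∉ with zero∉ here
... | ()

Adj-suc : ∀ {m f F u v} → Adj m F u v → Adj (suc m) (f ∷ F) (suc u) (suc v)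
Adj-suc (k , k∉ , inj₁ (refl , refl)) = suc k , (λ { (there k∈) → k∉ k∈ }) , inj₁ (refl , refl)
Adj-suc (k , k∉ , inj₂ (refl , refl)) = suc k , (λ { (there k∈) → k∉ k∈ }) , inj₂ (refl , refl)

Adj-into-zero : ∀ {m f F u} → Adj (suc m) (f ∷ F) u zero → u ≡ suc zero × f ≡ false
Adj-into-zero (zero , k∉ , inj₂ (refl , refl)) = refl , ∉-head k∉
Adj-into-zero (zero , _ , inj₁ (_ , ()))
Adj-into-zero (suc k , _ , inj₁ (_ , ()))
Adj-into-zero (suc k , _ , inj₂ (_ , ()))

Adj-into-suc : ∀ {m f F u v} → Adj (suc m) (f ∷ F) u (suc v) →
  (u ≡ zero × v ≡ zero × f ≡ false) ⊎ ∃[ w ] (u ≡ suc w × Adj m F w v)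
Adj-into-suc (zero , k∉ , inj₁ (refl , refl)) = inj₁ (refl , refl , ∉-head k∉)
Adj-into-suc (zero , _ , inj₂ (_ , ()))
Adj-into-suc (suc k , k∉ , inj₁ (refl , refl)) = inj₂ (inject₁ k , refl , k , (λ k∈ → k∉ (there k∈)) , inj₁ (refl , refl))
Adj-into-suc (suc k , k∉ , inj₂ (refl , refl)) = inj₂ (suc k , refl , k , (λ k∈ → k∉ (there k∈)) , inj₂ (refl , refl))

-- Domination read from left to right: a vertex with membership x is covered by itself, by its left
-- neighbour (flag l: that neighbour is in D and joined to it) or by its right neighbour y across
-- a present edge (f ≡ false).
data Covered : (x l f y : Bool) → Set where
  by-self  : ∀ {l f y} → Covered true l f y
  by-left  : ∀ {x f y} → Covered x true f y
  by-right : ∀ {x l} → Covered x l false true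

-- The last vertex is treated as having a deleted edge to a vertex outside D.
DomScan : ∀ {m} → Bool → Subset m → Subset (suc m) → Set
DomScan l []      (x ∷ [])    = Covered x l true false
DomScan l (f ∷ F) (x ∷ y ∷ D) = Covered x l f y × DomScan (not f ∧ x) F (y ∷ D)

DominatedFrom : ∀ {m} → Bool → Subset m → Subset (suc m) → Fin (suc m) → Set
DominatedFrom {m} l F D v = v ∈ D ⊎ (v ≡ zero × l ≡ true) ⊎ ∃[ u ] (u ∈ D × Adj m F u v)

DominatedFrom-zero⇒Covered : ∀ {m l f x y} {F : Subset m} {D} →
  DominatedFrom l (f ∷ F) (x ∷ y ∷ D) zero → Covered x l f y
DominatedFrom-zero⇒Covered (inj₁ here) = by-self
DominatedFrom-zero⇒Covered (inj₂ (inj₁ (_ , refl))) = by-left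
DominatedFrom-zero⇒Covered (inj₂ (inj₂ (u , u∈ , adj))) with Adj-into-zero adj
DominatedFrom-zero⇒Covered (inj₂ (inj₂ (_ , there here , _))) | refl , refl = by-right

DominatedFrom-suc⇒tail : ∀ {m l f x y} {F : Subset m} {D v} →
  DominatedFrom l (f ∷ F) (x ∷ y ∷ D) (suc v) → DominatedFrom (not f ∧ x) F (y ∷ D) v
DominatedFrom-suc⇒tail (inj₁ (there v∈)) = inj₁ v∈
DominatedFrom-suc⇒tail (inj₂ (inj₂ (u , u∈ , adj))) with Adj-into-suc adj
DominatedFrom-suc⇒tail (inj₂ (inj₂ (_ , here , _))) | inj₁ (refl , refl , refl) = inj₂ (inj₁ (refl , refl))
DominatedFrom-suc⇒tail (inj₂ (inj₂ (_ , there w∈ , _))) | inj₂ (w , refl , adj) = inj₂ (inj₂ (w , w∈ , adj))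

Covered⇒DominatedFrom-zero : ∀ {m l f x y} {F : Subset m} {D} →
  Covered x l f y → DominatedFrom l (f ∷ F) (x ∷ y ∷ D) zero
Covered⇒DominatedFrom-zero by-self = inj₁ here
Covered⇒DominatedFrom-zero by-left = inj₂ (inj₁ (refl , refl))
Covered⇒DominatedFrom-zero by-right = inj₂ (inj₂ (suc zero , there here , zero , (λ ()) , inj₂ (refl , refl)))

tail⇒DominatedFrom-suc : ∀ {m l f x y} {F : Subset m} {D v} →
  DominatedFrom (not f ∧ x) F (y ∷ D) v → DominatedFrom l (f ∷ F) (x ∷ y ∷ D) (suc v)
tail⇒DominatedFrom-suc (inj₁ v∈) = inj₁ (there v∈)
tail⇒DominatedFrom-suc {f = false} {x = true} (inj₂ (inj₁ (refl , refl))) =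
  inj₂ (inj₂ (zero , here , zero , (λ ()) , inj₁ (refl , refl)))
tail⇒DominatedFrom-suc (inj₂ (inj₂ (u , u∈ , adj))) = inj₂ (inj₂ (suc u , there u∈ , Adj-suc adj))

DomScan-complete : ∀ {m} l (F : Subset m) D → (∀ v → DominatedFrom l F D v) → DomScan l F D
DomScan-complete l [] (x ∷ []) dom with dom zero
... | inj₁ here = by-self
... | inj₂ (inj₁ (_ , refl)) = by-left
DomScan-complete l (f ∷ F) (x ∷ y ∷ D) dom =
  DominatedFrom-zero⇒Covered (dom zero) ,
  DomScan-complete _ F (y ∷ D) (λ v → DominatedFrom-suc⇒tail (dom (suc v)))

DomScan-sound : ∀ {m} l (F : Subset m) D → DomScan l F D → ∀ v → DominatedFrom l F D v
DomScan-sound l [] (x ∷ []) by-self zero = inj₁ here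
DomScan-sound l [] (x ∷ []) by-left zero = inj₂ (inj₁ (refl , refl))
DomScan-sound l (f ∷ F) (x ∷ y ∷ D) (c , _) zero = Covered⇒DominatedFrom-zero c
DomScan-sound l (f ∷ F) (x ∷ y ∷ D) (_ , s) (suc v) = tail⇒DominatedFrom-suc (DomScan-sound _ F (y ∷ D) s v)

Dominating⇒DomScan : ∀ {m F D} → Dominating m F D → DomScan false F D
Dominating⇒DomScan dom = DomScan-complete false _ _ λ v → [ inj₁ , (λ adj → inj₂ (inj₂ adj)) ]′ (dom v)

DomScan⇒Dominating : ∀ {m F D} → DomScan false F D → Dominating m F D
DomScan⇒Dominating s v with DomScan-sound false _ _ s v
... | inj₁ v∈ = inj₁ v∈
... | inj₂ (inj₂ adj) = inj₂ adj

mutual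
  DomScan-bound : ∀ {m} (D : Subset (suc m)) → DomScan false ⊥ D → suc m ≤ ∣ D ∣ * 3
  DomScan-bound {zero} (true ∷ []) _ = s≤s z≤n
  DomScan-bound {suc m} (true ∷ y ∷ D) (_ , s) = s≤s (s≤s (m≤n⇒m≤1+n (DomScan-boundˡ (y ∷ D) s)))
  DomScan-bound {suc zero} (false ∷ y ∷ []) (by-right , _) = s≤s (s≤s z≤n)
  DomScan-bound {suc (suc m)} (false ∷ y ∷ z ∷ D) (by-right , _ , s) = s≤s (s≤s (s≤s (DomScan-boundˡ (z ∷ D) s)))

  DomScan-boundˡ : ∀ {m} (D : Subset (suc m)) → DomScan true ⊥ D → m ≤ ∣ D ∣ * 3
  DomScan-boundˡ {zero} D _ = z≤n
  DomScan-boundˡ {suc m} (true ∷ y ∷ D) (_ , s) = s≤s (m≤n⇒m≤1+n (m≤n⇒m≤1+n (DomScan-boundˡ (y ∷ D) s)))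
  DomScan-boundˡ {suc m} (false ∷ y ∷ D) (_ , s) = DomScan-bound (y ∷ D) s

pathDominator : (n : ℕ) → Subset n
pathDominator 0 = []
pathDominator 1 = true ∷ []
pathDominator 2 = false ∷ true ∷ []
pathDominator (suc (suc (suc n))) = false ∷ true ∷ false ∷ pathDominator n

∣pathDominator∣ : ∀ n → ∣ pathDominator n ∣ ≡ ⌈ n /3⌉
∣pathDominator∣ 0 = refl
∣pathDominator∣ 1 = refl
∣pathDominator∣ 2 = refl
∣pathDominator∣ (suc (suc (suc n))) = cong suc (∣pathDominator∣ n)

DomScan-by-left : ∀ {m} {F : Subset m} {D} → DomScan false F D → DomScan true (false ∷ F) (false ∷ D)
DomScan-by-left {D = _ ∷ _} s = by-left , s

pathDominator-dominates : ∀ m → DomScan false (⊥ {m}) (pathDominator (suc m))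
pathDominator-dominates 0 = by-self
pathDominator-dominates 1 = by-right , by-self
pathDominator-dominates 2 = by-right , by-self , by-left
pathDominator-dominates (suc (suc (suc m))) = by-right , by-self , DomScan-by-left (pathDominator-dominates m)

path-domination : ∀ m → IsDomNumber m ⊥ ⌈ suc m /3⌉
path-domination m =
  (pathDominator (suc m) , DomScan⇒Dominating (pathDominator-dominates m) , ∣pathDominator∣ (suc m)) ,
  λ D dom → ⌈/3⌉-least (suc m) ∣ D ∣ (DomScan-bound D (Dominating⇒DomScan dom))

Covered-across-removed : ∀ {x l y y′} → Covered x l true y → Covered x l true y′
Covered-across-removed by-self = by-self
Covered-across-removed by-left = by-left

DomScan-split : ∀ {a b} l (F₁ : Subset a) {F₂ : Subset b} (D₁ : Subset (suc a)) (D₂ : Subset (suc b)) →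
  DomScan l (F₁ ++ true ∷ F₂) (D₁ ++ D₂) → DomScan l F₁ D₁ × DomScan false F₂ D₂
DomScan-split l [] (x ∷ []) (y ∷ D₂) (c , s) = Covered-across-removed c , s
DomScan-split l (f ∷ F₁) (x ∷ y ∷ D₁) D₂ (c , s) with DomScan-split _ F₁ (y ∷ D₁) D₂ s
... | s₁ , s₂ = (c , s₁) , s₂

DomScan-join : ∀ {a b} l (F₁ : Subset a) {F₂ : Subset b} (D₁ : Subset (suc a)) (D₂ : Subset (suc b)) →
  DomScan l F₁ D₁ → DomScan false F₂ D₂ → DomScan l (F₁ ++ true ∷ F₂) (D₁ ++ D₂)
DomScan-join l [] (x ∷ []) (y ∷ D₂) c s = Covered-across-removed c , s
DomScan-join l (f ∷ F₁) (x ∷ y ∷ D₁) D₂ (c , s₁) s₂ = c , DomScan-join _ F₁ (y ∷ D₁) D₂ s₁ s₂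

∣++∣ : ∀ {a b} (p : Subset a) (q : Subset b) → ∣ p ++ q ∣ ≡ ∣ p ∣ + ∣ q ∣
∣++∣ [] q = refl
∣++∣ (true ∷ p) q = cong suc (∣++∣ p q)
∣++∣ (false ∷ p) q = ∣++∣ p q

cut-domination : ∀ {a b F₁ F₂ g₁ g₂} → IsDomNumber a F₁ g₁ → IsDomNumber b F₂ g₂ →
  IsDomNumber (a + suc b) (F₁ ++ true ∷ F₂) (g₁ + g₂)
cut-domination {a} {F₁ = F₁} ((D₁ , dom₁ , refl) , least₁) ((D₂ , dom₂ , refl) , least₂) =
  (D₁ ++ D₂ ,
   DomScan⇒Dominating (DomScan-join false F₁ D₁ D₂ (Dominating⇒DomScan dom₁) (Dominating⇒DomScan dom₂)) ,
   ∣++∣ D₁ D₂) ,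
  least
  where
  least : ∀ D → Dominating _ _ D → _ ≤ ∣ D ∣
  least D dom with splitAt (suc a) D
  ... | D₁′ , D₂′ , refl with DomScan-split false F₁ D₁′ D₂′ (Dominating⇒DomScan dom)
  ... | s₁ , s₂ = subst (_ ≤_) (sym (∣++∣ D₁′ D₂′))
                    (+-mono-≤ (least₁ D₁′ (DomScan⇒Dominating s₁)) (least₂ D₂′ (DomScan⇒Dominating s₂)))

data Cut : (m : ℕ) → Fin m → Set where
  cut : ∀ a b → Cut (a + suc b) (a ↑ʳ zero)

cut-view : ∀ {m} (i : Fin m) → Cut m i
cut-view zero = cut 0 _
cut-view (suc i) with cut-view i
... | cut a b = cut (suc a) b

⁅↑ʳzero⁆ : ∀ a {b} → ⁅ a ↑ʳ zero ⁆ ≡ ⊥ {a} ++ true ∷ ⊥ {b}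
⁅↑ʳzero⁆ zero = refl
⁅↑ʳzero⁆ (suc a) = cong (false ∷_) (⁅↑ʳzero⁆ a)

single-edge-domination : ∀ a b → IsDomNumber (a + suc b) ⁅ a ↑ʳ zero ⁆ (⌈ suc a /3⌉ + ⌈ suc b /3⌉)
single-edge-domination a b rewrite ⁅↑ʳzero⁆ a {b} = cut-domination (path-domination a) (path-domination b)

Dominating-antimono : ∀ {m F G D} → F ⊆ G → Dominating m G D → Dominating m F D
Dominating-antimono F⊆G dom v with dom v
... | inj₁ v∈ = inj₁ v∈
... | inj₂ (u , u∈ , k , k∉G , edge) = inj₂ (u , u∈ , k , (λ k∈F → k∉G (F⊆G k∈F)) , edge)

γ<⇒Bondage : ∀ {m F g} → IsDomNumber m F g → ⌈ suc m /3⌉ < g → Bondage m F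
γ<⇒Bondage isDom γ<g = _ , _ , path-domination _ , isDom , γ<g

⊆-not-bondage : ∀ {m F G g} → F ⊆ G → IsDomNumber m G g → g ≤ ⌈ suc m /3⌉ → ¬ Bondage m F
⊆-not-bondage {m} F⊆G ((D , dom , refl) , _) g≤γ (_ , _ , ((D₀ , dom₀ , refl) , _) , (_ , least) , γ<γ′) =
  <⇒≱ γ<γ′ (begin
    _         ≤⟨ least D (Dominating-antimono F⊆G dom) ⟩
    ∣ D ∣     ≤⟨ g≤γ ⟩
    ⌈ suc m /3⌉ ≤⟨ proj₂ (path-domination m) D₀ dom₀ ⟩
    ∣ D₀ ∣    ∎)
  where open ≤-Reasoning

x∈p⇒1≤∣p∣ : ∀ {n} {x : Fin n} {p} → x ∈ p → 1 ≤ ∣ p ∣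
x∈p⇒1≤∣p∣ here = s≤s z≤n
x∈p⇒1≤∣p∣ {p = true ∷ _} (there _) = s≤s z≤n
x∈p⇒1≤∣p∣ {p = false ∷ _} (there x∈p) = x∈p⇒1≤∣p∣ x∈p

∣p∣≤1⇒⊆⁅⁆ : ∀ {n} (p : Subset (suc n)) → ∣ p ∣ ≤ 1 → ∃[ i ] p ⊆ ⁅ i ⁆
∣p∣≤1⇒⊆⁅⁆ (true ∷ p) (s≤s ∣p∣≤0) =
  zero , λ { here → here ; (there x∈p) → contradiction (x∈p⇒1≤∣p∣ x∈p) (<⇒≱ (s≤s ∣p∣≤0)) }
∣p∣≤1⇒⊆⁅⁆ {zero} (false ∷ []) _ = zero , λ { (there ()) }
∣p∣≤1⇒⊆⁅⁆ {suc n} (false ∷ p) ∣p∣≤1 with ∣p∣≤1⇒⊆⁅⁆ p ∣p∣≤1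
... | i , p⊆⁅i⁆ = suc i , λ { (there x∈p) → there (p⊆⁅i⁆ x∈p) }

Bondage⇒1≤∣F∣ : ∀ {m F} → Bondage m F → 1 ≤ ∣ F ∣
Bondage⇒1≤∣F∣ {m} {F} bF with 1 ≤? ∣ F ∣
... | yes 1≤∣F∣ = 1≤∣F∣
... | no 1≰∣F∣ = contradiction bF (⊆-not-bondage F⊆⊥ (path-domination m) ≤-refl)
  where
  F⊆⊥ : F ⊆ ⊥
  F⊆⊥ x∈F = contradiction (x∈p⇒1≤∣p∣ x∈F) 1≰∣F∣

-- The hypothesis suc ⌈ m /3⌉ ≤ ⌈ suc m /3⌉ says that the number suc m of vertices is ≡ 1 (mod 3).
single-edge-within-γ : ∀ {m} → suc ⌈ m /3⌉ ≤ ⌈ suc m /3⌉ → (i : Fin m) →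
  ∃[ g ] IsDomNumber m ⁅ i ⁆ g × g ≤ ⌈ suc m /3⌉
single-edge-within-γ jump i with cut-view i
... | cut a b = _ , single-edge-domination a b , ≤-trans (⌈/3⌉-split-≤ a b) jump

Bondage⇒2≤∣F∣ : ∀ {m F} → 1 ≤ m → suc ⌈ m /3⌉ ≤ ⌈ suc m /3⌉ → Bondage m F → 2 ≤ ∣ F ∣
Bondage⇒2≤∣F∣ {F = F} (s≤s _) jump bF with 2 ≤? ∣ F ∣
... | yes 2≤∣F∣ = 2≤∣F∣
... | no 2≰∣F∣ with ∣p∣≤1⇒⊆⁅⁆ F (≤-pred (≰⇒> 2≰∣F∣))
... | i , F⊆⁅i⁆ with single-edge-within-γ jump i
... | _ , γ⁅i⁆ , γ⁅i⁆≤γ = contradiction bF (⊆-not-bondage F⊆⁅i⁆ γ⁅i⁆ γ⁅i⁆≤γ)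

pendant-min-bondage : ∀ {m} → 1 ≤ m → (e : Fin m) → IsDomNumber m ⁅ e ⁆ (suc ⌈ m /3⌉) →
  (suc ⌈ m /3⌉ ≤ ⌈ suc m /3⌉ → ∃[ T ] ∣ T ∣ ≡ 2 × Bondage m T × e ∈ T) →
  Σ (Subset m) λ F → MinBondage m F × e ∈ F
pendant-min-bondage {m} 1≤m e γ⁅e⁆ pair with ⌈ suc m /3⌉ <? suc ⌈ m /3⌉
... | yes γ<γ⁅e⁆ =
  ⁅ e ⁆ , (γ<⇒Bondage γ⁅e⁆ γ<γ⁅e⁆ , λ F bF → subst (_≤ ∣ F ∣) (sym (∣⁅x⁆∣≡1 e)) (Bondage⇒1≤∣F∣ bF)) , x∈⁅x⁆ e
... | no γ≮γ⁅e⁆ with pair (≮⇒≥ γ≮γ⁅e⁆)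
... | T , ∣T∣≡2 , bT , e∈T =
  T , (bT , λ F bF → subst (_≤ ∣ F ∣) (sym ∣T∣≡2) (Bondage⇒2≤∣F∣ 1≤m (≮⇒≥ γ≮γ⁅e⁆) bF)) , e∈T

inject₁²≢suc² : ∀ {m} (k : Fin m) → inject₁ (inject₁ k) ≢ suc (suc k)
inject₁²≢suc² zero ()
inject₁²≢suc² (suc k) eq = inject₁²≢suc² k (suc-injective eq)

inner-vertex-not-degree1 : ∀ {m} (k : Fin m) → ¬ Degree1 (suc m) (suc (inject₁ k))
inner-vertex-not-degree1 k (_ , _ , unique) =
  inject₁²≢suc² k (trans (unique _ (inject₁ k , ∉⊥ , inj₂ (refl , refl)))
                         (sym (unique _ (suc k , ∉⊥ , inj₁ (refl , refl)))))

data LastView : (m : ℕ) → Fin m → Set where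
  last     : ∀ a → LastView (a + 1) (a ↑ʳ zero)
  not-last : ∀ {m} (k : Fin m) → LastView (suc m) (inject₁ k)

last-view : ∀ {m} (e : Fin m) → LastView m e
last-view {suc zero} zero = last 0
last-view {suc (suc m)} zero = not-last zero
last-view (suc e) with last-view e
... | last a = last (suc a)
... | not-last k = not-last (suc k)

first-edges-bondage : ∀ b → suc ⌈ suc b /3⌉ ≤ ⌈ suc (suc b) /3⌉ →
  ∃[ T ] ∣ T ∣ ≡ 2 × Bondage (suc b) T × zero ∈ T
first-edges-bondage zero (s≤s ())
first-edges-bondage (suc b) _ =
  true ∷ true ∷ ⊥ , cong (2 +_) (∣⊥∣≡0 b) ,
  γ<⇒Bondage (cut-domination (path-domination 0) (single-edge-domination 0 b)) (s≤s (s≤s (⌈/3⌉-mono-suc b))) ,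
  here

↑ʳzero∈ : ∀ {a b} (F : Subset a) {G : Subset b} → a ↑ʳ zero ∈ F ++ true ∷ G
↑ʳzero∈ [] = here
↑ʳzero∈ (_ ∷ F) = there (↑ʳzero∈ F)

-- The first and the last edge (rather than the last two), because this set lives in Subset (a + 1)
-- without any cast.
end-edges-bondage : ∀ a → suc ⌈ a + 1 /3⌉ ≤ ⌈ suc (a + 1) /3⌉ →
  ∃[ T ] ∣ T ∣ ≡ 2 × Bondage (a + 1) T × a ↑ʳ zero ∈ T
end-edges-bondage zero (s≤s ())
end-edges-bondage (suc a) _ =
  (true ∷ ⊥ {a}) ++ true ∷ [] , cong suc (trans (∣++∣ (⊥ {a}) (true ∷ [])) (cong (_+ 1) (∣⊥∣≡0 a))) ,
  γ<⇒Bondage (cut-domination (single-edge-domination 0 a) (path-domination 0)) γ<γ′ ,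
  ↑ʳzero∈ (true ∷ ⊥)
  where
  γ<γ′ : ⌈ suc (suc (a + 1)) /3⌉ < suc ⌈ suc a /3⌉ + 1
  γ<γ′ rewrite +-comm a 1 | +-comm ⌈ suc a /3⌉ 1 = s≤s (s≤s (⌈/3⌉-mono-suc a))

lemma1 : (m : ℕ) → 1 ≤ m → (e : Fin m) → Pendant m e →
    Σ (Subset m) λ F → MinBondage m F × e ∈ F
lemma1 (suc b) 1≤m zero _ =
  pendant-min-bondage 1≤m zero (single-edge-domination 0 b) (first-edges-bondage b)
lemma1 (suc m) 1≤m (suc e) (inj₁ d) = contradiction d (inner-vertex-not-degree1 e)
lemma1 m 1≤m e (inj₂ d) with last-view e
... | not-last k = contradiction d (inner-vertex-not-degree1 k)
... | last a = pendant-min-bondage 1≤m (a ↑ʳ zero) (subst (IsDomNumber _ _) γ-eq (single-edge-domination a 0))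
                 (end-edges-bondage a)
  where
  γ-eq : ⌈ suc a /3⌉ + 1 ≡ suc ⌈ a + 1 /3⌉
  γ-eq = trans (+-comm _ 1) (cong (λ n → 1 + ⌈ n /3⌉) (+-comm 1 a))
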